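{- For all $n>0$, with $\Phi_n(j)=\varphi(\mathcal{S}_n(j))$ as defined below, $\Phi_n(1)=(n+1)\,n\,\cdots\,1$ and $\Phi_n(r_n)=n\,\cdots\,1\,(n+1)$.
   Context: A Schröder path from $(0,0)$ to $(2n,0)$ is a lattice path using steps $\mathsf{u}=(1,1)$, $\mathsf{d}=(1,-1)$, $\mathsf{e}=(2,0)$ never going below the $x$-axis, written as a word in $\mathsf{u},\mathsf{d},\mathsf{e}$. Large Schröder numbers: $r_0=1$, $r_n=r_{n-1}+\sum_{k=1}^n r_{k-1}r_{n-k}$. Let $B(1)=0$, $B(i)=r_0+\cdots+r_{i-2}$ for $i>1$. For a list $\mathcal{S}_n$, $\mathcal{S}_n(j)$ is its $j$-th entry, and $\mathcal{S}_n^i(j)=\mathcal{S}_n(j)$ if $i$ is odd, $\mathcal{S}_n^i(j)=\mathcal{S}_n(r_n+1-j)$ if $i$ is even. With $\bigoplus$ denoting concatenation of lists in index order (outer index slowest), $\mathcal{S}_0=(\emptyset)$ and for $n\ge1$ $$\mathcal{S}_n=\bigoplus_{i=1}^{r_{n-1}}\big(\mathsf{e}\,\mathcal{S}_{n-1}(i)\big)\oplus\bigoplus_{i=1}^{n}\bigoplus_{j=1}^{r_{i-1}}\bigoplus_{k=1}^{r_{n-i}}\big(\mathsf{u}\,\mathcal{S}_{i-1}^{\,n+i}(j)\,\mathsf{d}\,\mathcal{S}_{n-i}^{\,j+B(i)+1}(k)\big).$$ The map $\varphi$ from Schröder paths $p$ from $(0,0)$ to $(2n,0)$ to permutations of $\{1,\ldots,n+1\}$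 is defined as follows. For $i\ge1$, $s_i$ acting on a permutation $\pi$ exchanges the entries $\pi_i$ and $\pi_{i+1}$; a product of such $s$'s acts by applying its rightmost factor first. Step 1: for all integers $a,m$ with $0\le a,m<n$, place a dot at the point $((8m+1)/4,(8a+5)/4)$ and/or $((8m+5)/4,(8a+1)/4)$ whenever that point lies in the region beneath $p$ and above the $x$-axis; a dot at $(x,y)$ receives the label $s_i$ with $i=(1+x-y)/2$. Set $j=1$. Step 2: choose the rightmost dot with no line yet associated with it (label $s_k$); draw a horizontal line from it to the leftmost dot that can be reached without crossing $p$ (label $s_l$); set $\sigma_j=s_ks_{k-1}\cdots s_l$. If all dots now lie on lines, go to Step 3; otherwise increase $j$ by one and repeat Step 2. Step 3: $\varphi(p)=\sigma_j\cdots\sigma_2\sigma_1\,(n+1,n,\ldots,1)$. Finally $\Phi_n(j):=\varphi(\mathcal{S}_n(j))$. -}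

module Defs where

open import Data.Nat using (ℕ; zero; suc; _+_; _*_; _∸_; _/_; _%_; _≤ᵇ_; _<ᵇ_; _≡ᵇ_)
open import Data.Bool using (Bool; true; false; if_then_else_; _∧_; not)
open import Data.List using (List; []; _∷_; _++_; map; concatMap; length; reverse; upTo; foldl; foldr; filterᵇ)
open import Data.Bool.ListAction using (and)
open import Data.Nat.ListAction using (sum)
open import Data.Product using (_×_; _,_; proj₁; proj₂)

-- Schröder paths as words in u, d, e

data Step : Set where
  u d e : Step

Word : Set
Word = List Step

range1 : ℕ → List ℕ
range1 m = map suc (upTo m)

-- 1-indexed entry L(j) of a list (default value outside 1..length L)
entry : {A : Set} → A → List A → ℕ → A
entry dflt []       _             = dflt
entry dflt (x ∷ xs) zero          = dflt
entry dflt (x ∷ xs) (suc zero)    = x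
entry dflt (x ∷ xs) (suc (suc j)) = entry dflt xs (suc j)

isOdd : ℕ → Bool
isOdd i = (i % 2) ≡ᵇ 1

-- Large Schröder numbers: r 0 = 1, r n = r (n-1) + Σ_{k=1}^n r (k-1) r (n-k)
-- (rF f is a fuel-indexed version; it is correct whenever f > argument)

rF : ℕ → ℕ → ℕ
rF zero    _       = 0
rF (suc f) zero    = 1
rF (suc f) (suc n) = rF f n + sum (map (λ k → rF f (k ∸ 1) * rF f (suc n ∸ k)) (range1 (suc n)))

r : ℕ → ℕ
r n = rF (suc n) n

B : ℕ → ℕ
B i = sum (map r (upTo (i ∸ 1)))

oriented : List Word → ℕ → ℕ → ℕ → Word
oriented Sm m i j = if isOdd i then entry [] Sm j else entry [] Sm (r m + 1 ∸ j)

buildS : (ℕ → List Word) → ℕ → List Word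
buildS S zero    = [] ∷ []
buildS S (suc n) =
  map (λ i → e ∷ entry [] (S n) i) (range1 (r n))
  ++ concatMap (λ i →
       concatMap (λ j →
         map (λ k → u ∷ (oriented (S (i ∸ 1)) (i ∸ 1) (suc n + i) j
                         ++ d ∷ oriented (S (suc n ∸ i)) (suc n ∸ i) (j + B i + 1) k))
             (range1 (r (suc n ∸ i))))
         (range1 (r (i ∸ 1))))
     (range1 (suc n))

-- fuel-indexed version; correct whenever the fuel exceeds the argument
SF : ℕ → ℕ → List Word
SF zero    _ = []
SF (suc f) n = buildS (SF f) n

S : ℕ → List Word
S n = SF (suc n) n

-- The map φ.  All coordinates are multiplied by 4, so the dot
-- ((8m+1)/4, (8a+5)/4) is represented by (8m+1, 8a+5), etc.

-- 4·(height of the path p at abscissa X/4), for X in [0, 4·length]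
h4go : ℕ → ℕ → Word → ℕ → ℕ
h4go x y []      X = 0
h4go x y (u ∷ p) X = if X ≤ᵇ x + 4 then y + (X ∸ x) else h4go (x + 4) (y + 4) p X
h4go x y (d ∷ p) X = if X ≤ᵇ x + 4 then y ∸ (X ∸ x) else h4go (x + 4) (y ∸ 4) p X
h4go x y (e ∷ p) X = if X ≤ᵇ x + 8 then y else h4go (x + 8) y p X

h4 : Word → ℕ → ℕ
h4 p X = h4go 0 0 p X

under : Word → ℕ → ℕ → Bool
under p X Y = (0 <ᵇ Y) ∧ (Y <ᵇ h4 p X)

Dot : Set
Dot = ℕ × ℕ

dots : ℕ → Word → List Dot
dots n p = filterᵇ (λ q → under p (proj₁ q) (proj₂ q))
  (concatMap (λ m → concatMap (λ a → (8 * m + 1 , 8 * a + 5) ∷ (8 * m + 5 , 8 * a + 1) ∷ []) (upTo n)) (upTo n))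

-- label s_i with i = (1 + x - y)/2, i.e. (4 + X - Y)/8 in scaled coordinates
label : Dot → ℕ
label q = (4 + proj₁ q ∸ proj₂ q) / 8

-- the horizontal segment at height Y/4 from X'/4 to X/4 lies beneath p
-- (p is piecewise linear with breakpoints at integer scaled abscissae,
--  so it suffices to test all integer scaled abscissae in [X', X])
segUnder : Word → ℕ → ℕ → ℕ → Bool
segUnder p Y X' X = and (map (λ t → under p t Y) (map (X' +_) (upTo (suc (X ∸ X')))))

rightmost : Dot → List Dot → Dot
rightmost c cs = foldl (λ best q → if proj₁ best <ᵇ proj₁ q then q else best) c cs

-- Step 2 iterated: returns the list of pairs (k , l) of σ_1, σ_2, ...,
-- where σ_j = s_k s_{k-1} ⋯ s_l.  Arguments: fuel, path, all dots,
-- dots not yet on a line.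
lines : ℕ → Word → List Dot → List Dot → List (ℕ × ℕ)
lines zero    p ds _        = []
lines (suc f) p ds []       = []
lines (suc f) p ds (c ∷ cs) =
  let q  = rightmost c cs
      X  = proj₁ q
      Y  = proj₂ q
      reach = filterᵇ (λ q' → (proj₂ q' ≡ᵇ Y) ∧ (proj₁ q' ≤ᵇ X) ∧ segUnder p Y (proj₁ q') X) ds
      X' = foldl (λ m q' → if proj₁ q' <ᵇ m then proj₁ q' else m) X reach
      rest = filterᵇ (λ q' → not ((proj₂ q' ≡ᵇ Y) ∧ (X' ≤ᵇ proj₁ q') ∧ (proj₁ q' ≤ᵇ X))) (c ∷ cs)
  in (label q , label (X' , Y)) ∷ lines f p ds rest

-- Permutations in one-line notation; s_i exchanges the entries in
-- positions i and i+1.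

swapAt : ℕ → List ℕ → List ℕ
swapAt zero          π            = π
swapAt (suc zero)    []           = []
swapAt (suc zero)    (a ∷ [])     = a ∷ []
swapAt (suc zero)    (a ∷ b ∷ π)  = b ∷ a ∷ π
swapAt (suc (suc i)) []           = []
swapAt (suc (suc i)) (a ∷ π)      = a ∷ swapAt (suc i) π

-- σ = s_k s_{k-1} ⋯ s_l acting on π (rightmost factor s_l first)
applySigma : ℕ × ℕ → List ℕ → List ℕ
applySigma kl π = foldl (λ ρ i → swapAt i ρ) π
  (map (proj₂ kl +_) (upTo (suc (proj₁ kl ∸ proj₂ kl))))

longest : ℕ → List ℕ
longest n = reverse (range1 (suc n))

φ : ℕ → Word → List ℕ
φ n p = let ds = dots n p in
  foldl (λ π σ → applySigma σ π) (longest n) (lines (length ds) p ds ds)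

Φ : ℕ → ℕ → List ℕ
Φ n j = φ n (entry [] (S n) j)

-- The first path of S_n is e^n, since S_n begins with e S_{n-1}; it has no dots beneath it,
-- so φ returns the initial permutation (n+1, n, ..., 1).  The last path of S_{n+1} is
-- u S_n^{2n+2}(r_n) d S_0, and the even orientation reverses S_n, so it is u S_n(1) d = u e^n d.
-- Beneath u e^n d the only dots lie at height 1/4, one per unit interval, and a single
-- horizontal line joins them all; hence σ_1 = s_{n+1} ⋯ s_1, which moves the first entry
-- n+2 of (n+2, n+1, ..., 1) to the end.
module Submission where

open import Defs
open import Data.Bool using (Bool; true; false; T; if_then_else_; _∧_; not)
open import Data.Bool.ListAction using (and)
open import Data.Bool.Properties using (T-∧; if-eta)
open import Data.Empty using (⊥-elim)
open import Data.List
  using (List; []; _∷_; _++_; _∷ʳ_; reverse; map; concat; concatMap; length; upTo; foldl; filterᵇ; applyUpTo; replicate)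
open import Data.List.Properties
open import Data.List.Relation.Unary.All as All using (All; []; _∷_)
open import Data.List.Relation.Unary.All.Properties using (map⁺; concat⁺; applyUpTo⁺₁)
open import Data.Nat
  using (ℕ; zero; suc; _+_; _*_; _∸_; _/_; _%_; _≤_; _<_; _≤ᵇ_; _<ᵇ_; _≡ᵇ_; z≤n; s≤s; z<s; s<s)
open import Data.Nat.DivMod using (m*n%n≡0; m*n/n≡m)
open import Data.Nat.ListAction using (sum)
open import Data.Nat.Properties
open import Data.Product using (_×_; _,_; proj₁; proj₂; ∃-syntax)
open import Function using (_∘_; flip)
open import Function.Bundles using (Equivalence)
open import Relation.Nullary using (¬_)
open import Relation.Nullary.Decidable using (T?)
open import Relation.Binary.PropositionalEquality
  using (_≡_; refl; sym; trans; cong; cong₂; subst; module ≡-Reasoning)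
open ≡-Reasoning

private variable
  A : Set

T⇒≡true : ∀ {b} → T b → b ≡ true
T⇒≡true {true} _ = refl

¬T⇒≡false : ∀ {b} → ¬ T b → b ≡ false
¬T⇒≡false {false} _  = refl
¬T⇒≡false {true}  ¬t = ⊥-elim (¬t _)

≤ᵇ-true : ∀ {m n} → m ≤ n → (m ≤ᵇ n) ≡ true
≤ᵇ-true = T⇒≡true ∘ ≤⇒≤ᵇ

<ᵇ-true : ∀ {m n} → m < n → (m <ᵇ n) ≡ true
<ᵇ-true = T⇒≡true ∘ <⇒<ᵇ

≤ᵇ-false : ∀ {m n} → n < m → (m ≤ᵇ n) ≡ false
≤ᵇ-false {m} {n} n<m = ¬T⇒≡false (<⇒≱ n<m ∘ ≤ᵇ⇒≤ m n)

<ᵇ-false : ∀ {m n} → n ≤ m → (m <ᵇ n) ≡ false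
<ᵇ-false {m} {n} n≤m = ¬T⇒≡false (flip <⇒≱ n≤m ∘ <ᵇ⇒< m n)

T-∧-intro : ∀ {a b} → T a → T b → T (a ∧ b)
T-∧-intro ta tb = Equivalence.from T-∧ (ta , tb)

T⇒¬T-not : ∀ {b} → T b → ¬ T (not b)
T⇒¬T-not {true} _ ()

T-and : ∀ {bs} → All T bs → T (and bs)
T-and []       = _
T-and (t ∷ ts) = T-∧-intro t (T-and ts)

applyUpTo-cong : ∀ {f g : ℕ → A} k → (∀ {t} → t < k → f t ≡ g t) → applyUpTo f k ≡ applyUpTo g k
applyUpTo-cong zero    f≡g = refl
applyUpTo-cong (suc k) f≡g = cong₂ _∷_ (f≡g z<s) (applyUpTo-cong k (f≡g ∘ s<s))

filterᵇ-concatMap : ∀ {B : Set} (p : B → Bool) (f : A → List B) xs →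
  filterᵇ p (concatMap f xs) ≡ concatMap (filterᵇ p ∘ f) xs
filterᵇ-concatMap p f []       = refl
filterᵇ-concatMap p f (x ∷ xs) =
  trans (filter-++ (T? ∘ p) (f x) _) (cong (filterᵇ p (f x) ++_) (filterᵇ-concatMap p f xs))

concat-applyUpTo-[_] : ∀ (f : ℕ → A) k → concat (applyUpTo (λ t → f t ∷ []) k) ≡ applyUpTo f k
concat-applyUpTo-[ f ] k = trans (cong concat (sym (map-applyUpTo f (_∷ []) k))) (concat-map-[ applyUpTo f k ])

length-concatMap : ∀ {B : Set} (f : A → List B) xs → length (concatMap f xs) ≡ sum (map (length ∘ f) xs)
length-concatMap f []       = refl
length-concatMap f (x ∷ xs) = trans (length-++ (f x)) (cong (length (f x) +_) (length-concatMap f xs))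

sum-map-const : ∀ b (xs : List A) → sum (map (λ _ → b) xs) ≡ length xs * b
sum-map-const b []       = refl
sum-map-const b (x ∷ xs) = cong (b +_) (sum-map-const b xs)

map-range1 : ∀ (f : ℕ → A) m → map f (range1 m) ≡ applyUpTo (f ∘ suc) m
map-range1 f m = trans (sym (map-∘ (upTo m))) (map-upTo (f ∘ suc) m)

map-range1-cong : ∀ {f g : ℕ → A} m → (∀ {t} → t < m → f (suc t) ≡ g (suc t)) → map f (range1 m) ≡ map g (range1 m)
map-range1-cong {f = f} {g} m f≡g = begin
  map f (range1 m)          ≡⟨ map-range1 f m ⟩
  applyUpTo (f ∘ suc) m     ≡⟨ applyUpTo-cong m f≡g ⟩
  applyUpTo (g ∘ suc) m     ≡⟨ map-range1 g m ⟨
  map g (range1 m)          ∎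

length-range1 : ∀ m → length (range1 m) ≡ m
length-range1 m = trans (length-map suc (upTo m)) (length-upTo m)

range1-suc : ∀ m → range1 (suc m) ≡ range1 m ∷ʳ suc m
range1-suc m = trans (cong (map suc) (sym (upTo-∷ʳ m))) (map-++ suc (upTo m) (m ∷ []))

length-grid : ∀ a b (G : ℕ → ℕ → A) → length (concatMap (λ j → map (G j) (range1 b)) (range1 a)) ≡ a * b
length-grid a b G = begin
  length (concatMap (λ j → map (G j) (range1 b)) (range1 a))  ≡⟨ length-concatMap (λ j → map (G j) (range1 b)) (range1 a) ⟩
  sum (map (λ j → length (map (G j) (range1 b))) (range1 a))  ≡⟨ cong sum (map-cong (λ j → trans (length-map (G j) (range1 b)) (length-range1 b)) (range1 a)) ⟩
  sum (map (λ _ → b) (range1 a))                              ≡⟨ sum-map-const b (range1 a) ⟩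
  length (range1 a) * b                                       ≡⟨ cong (_* b) (length-range1 a) ⟩
  a * b                                                       ∎

rF-fuel-irrelevant : ∀ f g m → m < f → m < g → rF f m ≡ rF g m
rF-fuel-irrelevant (suc f) (suc g) zero    _          _          = refl
rF-fuel-irrelevant (suc f) (suc g) (suc n) (s<s n<f) (s<s n<g) =
  cong₂ _+_ (rF-fuel-irrelevant f g n n<f n<g)
            (cong sum (map-range1-cong (suc n) λ {t} t<sn →
               cong₂ _*_ (irrelevant t (≤-pred t<sn)) (irrelevant (n ∸ t) (m∸n≤m n t))))
  where
  irrelevant : ∀ k → k ≤ n → rF f k ≡ rF g k
  irrelevant k k≤n = rF-fuel-irrelevant f g k (≤-<-trans k≤n n<f) (≤-<-trans k≤n n<g)

rF≡r : ∀ f m → m < f → rF f m ≡ r m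
rF≡r f m m<f = rF-fuel-irrelevant f (suc m) m m<f ≤-refl

r-positive : ∀ n → 0 < r n
r-positive zero    = z<s
r-positive (suc n) = ≤-trans (r-positive n) (m≤m+n (r n) _)

buildCell : (ℕ → List Word) → ℕ → ℕ → ℕ → ℕ → Word
buildCell prev n i j k =
  u ∷ oriented (prev (i ∸ 1)) (i ∸ 1) (suc n + i) j ++ d ∷ oriented (prev (suc n ∸ i)) (suc n ∸ i) (j + B i + 1) k

buildBlock : (ℕ → List Word) → ℕ → ℕ → List Word
buildBlock prev n i = concatMap (λ j → map (buildCell prev n i j) (range1 (r (suc n ∸ i)))) (range1 (r (i ∸ 1)))

buildS-suc : ∀ prev n →
  buildS prev (suc n) ≡ map (λ i → e ∷ entry [] (prev n) i) (range1 (r n)) ++ concatMap (buildBlock prev n) (range1 (suc n))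
buildS-suc prev n = refl

length-buildS : ∀ prev n → length (buildS prev n) ≡ r n
length-buildS prev zero    = refl
length-buildS prev (suc n) = begin
  length (buildS prev (suc n))
    ≡⟨ cong length (buildS-suc prev n) ⟩
  length (eBlock ++ concatMap (buildBlock prev n) (range1 (suc n)))
    ≡⟨ length-++ eBlock ⟩
  length eBlock + length (concatMap (buildBlock prev n) (range1 (suc n)))
    ≡⟨ cong₂ _+_ (trans (length-map _ (range1 (r n))) (length-range1 (r n)))
                 (length-concatMap (buildBlock prev n) (range1 (suc n))) ⟩
  r n + sum (map (length ∘ buildBlock prev n) (range1 (suc n)))
    ≡⟨ cong (λ xs → r n + sum xs)
            (map-cong (λ i → length-grid (r (i ∸ 1)) (r (suc n ∸ i)) (buildCell prev n i)) (range1 (suc n))) ⟩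
  r n + sum (map (λ i → r (i ∸ 1) * r (suc n ∸ i)) (range1 (suc n)))
    ≡⟨ cong (λ xs → r n + sum xs) (map-range1-cong (suc n) λ {t} t<sn →
         cong₂ _*_ (sym (rF≡r (suc n) t t<sn)) (sym (rF≡r (suc n) (n ∸ t) (s≤s (m∸n≤m n t))))) ⟩
  r (suc n) ∎
  where
  eBlock : List Word
  eBlock = map (λ i → e ∷ entry [] (prev n) i) (range1 (r n))

flat : ℕ → Word
flat n = replicate n e

hat : ℕ → Word
hat n = u ∷ flat n ++ d ∷ []

entry-1-map-range1 : ∀ (x : A) (f : ℕ → A) m ys → 0 < m → entry x (map f (range1 m) ++ ys) 1 ≡ f 1
entry-1-map-range1 x f (suc m) ys _ = refl

S-first : ∀ n → entry [] (S n) 1 ≡ flat n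
S-first zero    = refl
S-first (suc n) = trans (entry-1-map-range1 [] _ (r n) _ (r-positive n)) (cong (e ∷_) (S-first n))

_EndsWith_ : List A → A → Set
xs EndsWith w = ∃[ ys ] xs ≡ ys ∷ʳ w

++-EndsWith : ∀ (xs : List A) {ys w} → ys EndsWith w → (xs ++ ys) EndsWith w
++-EndsWith xs (zs , refl) = xs ++ zs , sym (++-assoc xs zs _)

concatMap-range1-EndsWith : ∀ {B : Set} (f : ℕ → List B) m {w} → 0 < m → f m EndsWith w → concatMap f (range1 m) EndsWith w
concatMap-range1-EndsWith f (suc m) {w} _ fm-ends = subst (_EndsWith w) (sym split) (++-EndsWith _ fm-ends)
  where
  split : concatMap f (range1 (suc m)) ≡ concatMap f (range1 m) ++ f (suc m)
  split = begin
    concatMap f (range1 (suc m))                      ≡⟨ cong (concatMap f) (range1-suc m) ⟩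
    concatMap f (range1 m ∷ʳ suc m)                   ≡⟨ concatMap-++ f (range1 m) (suc m ∷ []) ⟩
    concatMap f (range1 m) ++ (f (suc m) ++ [])       ≡⟨ cong (concatMap f (range1 m) ++_) (++-identityʳ (f (suc m))) ⟩
    concatMap f (range1 m) ++ f (suc m)               ∎

entry-length-EndsWith : ∀ (x : A) xs {w} → xs EndsWith w → entry x xs (length xs) ≡ w
entry-length-EndsWith x _ ([]         , refl) = refl
entry-length-EndsWith x _ (y ∷ []     , refl) = refl
entry-length-EndsWith x _ (y ∷ z ∷ ys , refl) = entry-length-EndsWith x (z ∷ ys ∷ʳ _) (z ∷ ys , refl)

singleton-range1-EndsWith : ∀ (g : ℕ → ℕ → A) z → z ≡ 0 → map (g z) (range1 (r z)) EndsWith g 0 1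
singleton-range1-EndsWith g .0 refl = [] , refl

-- The last entry of S_{n+1} is the term i = n+1, j = r_n, k = 1 of the recursion.
buildS-EndsWith : ∀ prev n → buildS prev (suc n) EndsWith
  (u ∷ oriented (prev n) n (suc n + suc n) (r n) ++ d ∷ oriented (prev 0) 0 (r n + B (suc n) + 1) 1)
buildS-EndsWith prev n =
  subst (_EndsWith lastColumn 0 1) (sym (buildS-suc prev n))
    (++-EndsWith (map (λ i → e ∷ entry [] (prev n) i) (range1 (r n)))
      (concatMap-range1-EndsWith (buildBlock prev n) (suc n) z<s
      (concatMap-range1-EndsWith (λ j → map (buildCell prev n (suc n) j) (range1 (r (n ∸ n)))) (r n) (r-positive n)
        (singleton-range1-EndsWith lastColumn (n ∸ n) (n∸n≡0 n)))))
  where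
  lastColumn : ℕ → ℕ → Word
  lastColumn z k = u ∷ oriented (prev n) n (suc n + suc n) (r n) ++ d ∷ oriented (prev z) z (r n + B (suc n) + 1) k

isOdd-+-self : ∀ m → isOdd (m + m) ≡ false
isOdd-+-self m = cong (_≡ᵇ 1) (begin
  (m + m) % 2        ≡⟨ cong (λ k → (m + k) % 2) (+-identityʳ m) ⟨
  (2 * m) % 2        ≡⟨ cong (_% 2) (*-comm 2 m) ⟩
  (m * 2) % 2        ≡⟨ m*n%n≡0 m 2 ⟩
  0                  ∎)

oriented-even : ∀ L m i j → isOdd i ≡ false → oriented L m i j ≡ entry [] L (r m + 1 ∸ j)
oriented-even L m i j even = cong (λ b → if b then entry [] L j else entry [] L (r m + 1 ∸ j)) even

S-last : ∀ n → entry [] (S (suc n)) (r (suc n)) ≡ hat n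
S-last n = begin
  entry [] (S (suc n)) (r (suc n))
    ≡⟨ cong (entry [] (S (suc n))) (length-buildS (SF (suc n)) (suc n)) ⟨
  entry [] (S (suc n)) (length (S (suc n)))
    ≡⟨ entry-length-EndsWith [] (S (suc n)) (buildS-EndsWith (SF (suc n)) n) ⟩
  u ∷ oriented (S n) n (suc n + suc n) (r n) ++ d ∷ oriented ([] ∷ []) 0 (r n + B (suc n) + 1) 1
    ≡⟨ cong₂ (λ p q → u ∷ p ++ d ∷ q) lastReversed (if-eta (isOdd (r n + B (suc n) + 1))) ⟩
  hat n ∎
  where
  lastReversed : oriented (S n) n (suc n + suc n) (r n) ≡ flat n
  lastReversed = begin
    oriented (S n) n (suc n + suc n) (r n)  ≡⟨ oriented-even (S n) n (suc n + suc n) (r n) (isOdd-+-self (suc n)) ⟩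
    entry [] (S n) (r n + 1 ∸ r n)          ≡⟨ cong (entry [] (S n)) (m+n∸m≡n (r n) 1) ⟩
    entry [] (S n) 1                        ≡⟨ S-first n ⟩
    flat n                                  ∎

under-true : ∀ p X {Y} → 0 < Y → Y < h4 p X → T (under p X Y)
under-true p X 0<Y Y<h = T-∧-intro (<⇒<ᵇ 0<Y) (<⇒<ᵇ Y<h)

under-false : ∀ p X {Y} → h4 p X ≤ Y → ¬ T (under p X Y)
under-false p X {Y} h≤Y t = <⇒≱ (<ᵇ⇒< Y (h4 p X) (proj₂ (Equivalence.to T-∧ t))) h≤Y

segUnder-true : ∀ p Y {X' X} → X' ≤ X → (∀ {t} → X' ≤ t → t ≤ X → T (under p t Y)) → T (segUnder p Y X' X)
segUnder-true p Y {X'} {X} X'≤X below =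
  T-and (map⁺ (map⁺ (applyUpTo⁺₁ (λ s → s) (suc (X ∸ X')) λ {s} s≤X-X' →
    below (m≤m+n X' s) (≤-trans (+-monoʳ-≤ X' (≤-pred s≤X-X')) (≤-reflexive (m+[n∸m]≡n X'≤X))))))

underPath : Word → Dot → Bool
underPath p q = under p (proj₁ q) (proj₂ q)

candidate : ℕ → ℕ → List Dot
candidate t a = (8 * t + 1 , 8 * a + 5) ∷ (8 * t + 5 , 8 * a + 1) ∷ []

candidateColumn : ℕ → ℕ → List Dot
candidateColumn n t = concatMap (candidate t) (upTo n)

candidates : ℕ → List Dot
candidates n = concatMap (candidateColumn n) (upTo n)

φ-via-dots : ∀ n p ds → dots n p ≡ ds → φ n p ≡ foldl (flip applySigma) (longest n) (lines (length ds) p ds ds)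
φ-via-dots n p _ refl = refl

h4go-flat : ∀ k x X → h4go x 0 (flat k) X ≡ 0
h4go-flat zero    x X = refl
h4go-flat (suc k) x X with X ≤ᵇ x + 8
... | true  = refl
... | false = h4go-flat k (x + 8) X

dots-flat : ∀ n → dots n (flat n) ≡ []
dots-flat n = filter-none (T? ∘ underPath (flat n)) (All.universal flatIsEmpty (candidates n))
  where
  flatIsEmpty : ∀ q → ¬ T (under (flat n) (proj₁ q) (proj₂ q))
  flatIsEmpty (X , Y) = under-false (flat n) X (subst (_≤ Y) (sym (h4go-flat n 0 X)) z≤n)

φ-flat : ∀ n → φ n (flat n) ≡ longest n
φ-flat n = φ-via-dots n (flat n) [] (dots-flat n)

h4go-hat-tail-≤4 : ∀ k x X → h4go x 4 (flat k ++ d ∷ []) X ≤ 4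
h4go-hat-tail-≤4 zero x X with X ≤ᵇ x + 4
... | true  = m∸n≤m 4 (X ∸ x)
... | false = z≤n
h4go-hat-tail-≤4 (suc k) x X with X ≤ᵇ x + 8
... | true  = ≤-refl
... | false = h4go-hat-tail-≤4 k (x + 8) X

h4-hat-≤4 : ∀ m X → h4 (hat m) X ≤ 4
h4-hat-≤4 m X with X ≤ᵇ 4 in eq
... | true  = ≤ᵇ⇒≤ X 4 (subst T (sym eq) _)
... | false = h4go-hat-tail-≤4 m 4 X

1<h4go-hat-tail : ∀ k x X → x < X → X ≤ x + (8 * k + 1) → 1 < h4go x 4 (flat k ++ d ∷ []) X
1<h4go-hat-tail zero x X x<X X≤x+1 rewrite ≤ᵇ-true {X} {x + 4} (≤-trans X≤x+1 (+-monoʳ-≤ x (s≤s z≤n))) =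
  ≤-trans (s≤s (s≤s z≤n)) (∸-monoʳ-≤ 4 (m≤n+o⇒m∸n≤o X x X≤x+1))
1<h4go-hat-tail (suc k) x X x<X X≤ with X ≤ᵇ x + 8 in eq
... | true  = s≤s (s≤s z≤n)
... | false = 1<h4go-hat-tail k (x + 8) X (≰⇒> λ X≤x+8 → subst T eq (≤⇒≤ᵇ X≤x+8))
                (≤-trans X≤ (≤-reflexive shift))
  where
  shift : x + (8 * suc k + 1) ≡ x + 8 + (8 * k + 1)
  shift = trans (cong (λ z → x + (z + 1)) (*-suc 8 k)) (sym (+-assoc x 8 (8 * k + 1)))

1<h4-hat : ∀ m X → 5 ≤ X → X ≤ 8 * m + 5 → 1 < h4 (hat m) X
1<h4-hat m X 5≤X X≤ rewrite ≤ᵇ-false {X} {4} 5≤X =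
  1<h4go-hat-tail m 4 X 5≤X (≤-trans X≤ (≤-reflexive (trans (+-comm (8 * m) 5) (cong (4 +_) (+-comm 1 (8 * m))))))

under-hat-high : ∀ m X {Y} → 4 ≤ Y → ¬ T (under (hat m) X Y)
under-hat-high m X 4≤Y = under-false (hat m) X (≤-trans (h4-hat-≤4 m X) 4≤Y)

under-hat-low : ∀ m {X} → 5 ≤ X → X ≤ 8 * m + 5 → T (under (hat m) X 1)
under-hat-low m {X} 5≤X X≤ = under-true (hat m) X z<s (1<h4-hat m X 5≤X X≤)

hatDot : ℕ → Dot
hatDot t = (8 * t + 5 , 1)

5≤hatDot : ∀ t → 5 ≤ proj₁ (hatDot t)
5≤hatDot t = m≤n+m 5 (8 * t)

hatDot-mono-≤ : ∀ {s t} → s ≤ t → proj₁ (hatDot s) ≤ proj₁ (hatDot t)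
hatDot-mono-≤ s≤t = +-monoˡ-≤ 5 (*-monoʳ-≤ 8 s≤t)

hatDot-increasing : ∀ t → proj₁ (hatDot t) < proj₁ (hatDot (suc t))
hatDot-increasing t = +-monoˡ-< 5 (*-monoʳ-< 8 (n<1+n t))

4≤8*[1+a]+b : ∀ a b → 4 ≤ 8 * suc a + b
4≤8*[1+a]+b a b = ≤-trans (≤-trans (m≤m+n 4 4) (*-monoʳ-≤ 8 (s≤s (z≤n {a})))) (m≤m+n (8 * suc a) b)

dots-hat : ∀ m → dots (suc m) (hat m) ≡ applyUpTo hatDot (suc m)
dots-hat m = begin
  filterᵇ P (concatMap column (upTo (suc m)))       ≡⟨ filterᵇ-concatMap P column (upTo (suc m)) ⟩
  concatMap (filterᵇ P ∘ column) (upTo (suc m))     ≡⟨ cong concat (map-upTo (filterᵇ P ∘ column) (suc m)) ⟩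
  concat (applyUpTo (filterᵇ P ∘ column) (suc m))   ≡⟨ cong concat (applyUpTo-cong (suc m) (filter-column ∘ ≤-pred)) ⟩
  concat (applyUpTo (λ t → hatDot t ∷ []) (suc m))  ≡⟨ concat-applyUpTo-[ hatDot ] (suc m) ⟩
  applyUpTo hatDot (suc m)                          ∎
  where
  P : Dot → Bool
  P = underPath (hat m)

  column : ℕ → List Dot
  column = candidateColumn (suc m)

  filter-column : ∀ {t} → t ≤ m → filterᵇ P (column t) ≡ hatDot t ∷ []
  filter-column {t} t≤m = begin
    filterᵇ P ((8 * t + 1 , 5) ∷ hatDot t ∷ higher)
      ≡⟨ filter-reject (T? ∘ P) {x = (8 * t + 1 , 5)} {xs = hatDot t ∷ higher} (under-hat-high m (8 * t + 1) (m≤m+n 4 1)) ⟩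
    filterᵇ P (hatDot t ∷ higher)
      ≡⟨ filter-accept (T? ∘ P) {xs = higher} (under-hat-low m (5≤hatDot t) (hatDot-mono-≤ t≤m)) ⟩
    hatDot t ∷ filterᵇ P higher
      ≡⟨ cong (hatDot t ∷_) (filter-none (T? ∘ P) (All.map (λ {q} → under-hat-high m (proj₁ q)) higher-high)) ⟩
    hatDot t ∷ [] ∎
    where
    higher : List Dot
    higher = concatMap (candidate t) (applyUpTo suc m)

    higher-high : All (λ q → 4 ≤ proj₂ q) higher
    higher-high = concat⁺ (map⁺ (applyUpTo⁺₁ suc m λ {a} _ → 4≤8*[1+a]+b a 5 ∷ 4≤8*[1+a]+b a 1 ∷ []))

rightmostStep : Dot → Dot → Dot
rightmostStep best q = if proj₁ best <ᵇ proj₁ q then q else best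

leftmostStep : ℕ → Dot → ℕ
leftmostStep x q = if proj₁ q <ᵇ x then proj₁ q else x

reachableFrom : Word → Dot → Dot → Bool
reachableFrom p q q' = (proj₂ q' ≡ᵇ proj₂ q) ∧ (proj₁ q' ≤ᵇ proj₁ q) ∧ segUnder p (proj₂ q) (proj₁ q') (proj₁ q)

offSegment : ℕ → Dot → Dot → Bool
offSegment X' q q' = not ((proj₂ q' ≡ᵇ proj₂ q) ∧ (X' ≤ᵇ proj₁ q') ∧ (proj₁ q' ≤ᵇ proj₁ q))

lines-unfold : ∀ f p ds c cs {q X' rest} →
  foldl rightmostStep c cs ≡ q →
  foldl leftmostStep (proj₁ q) (filterᵇ (reachableFrom p q) ds) ≡ X' →
  filterᵇ (offSegment X' q) (c ∷ cs) ≡ rest →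
  lines (suc f) p ds (c ∷ cs) ≡ (label q , label (X' , proj₂ q)) ∷ lines f p ds rest
lines-unfold f p ds c cs refl refl refl = refl

lines-[] : ∀ f p ds → lines f p ds [] ≡ []
lines-[] zero    p ds = refl
lines-[] (suc f) p ds = refl

foldl-rightmostStep-increasing : ∀ k (f : ℕ → Dot) acc → proj₁ acc < proj₁ (f 0) →
  (∀ t → proj₁ (f t) < proj₁ (f (suc t))) → foldl rightmostStep acc (applyUpTo f (suc k)) ≡ f k
foldl-rightmostStep-increasing zero    f acc acc<f0 inc rewrite <ᵇ-true acc<f0 = refl
foldl-rightmostStep-increasing (suc k) f acc acc<f0 inc rewrite <ᵇ-true acc<f0 =
  foldl-rightmostStep-increasing k (f ∘ suc) (f 0) (inc 0) (inc ∘ suc)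

rightmost-increasing : ∀ k (f : ℕ → Dot) → (∀ t → proj₁ (f t) < proj₁ (f (suc t))) →
  foldl rightmostStep (f 0) (applyUpTo (f ∘ suc) k) ≡ f k
rightmost-increasing zero    f inc = refl
rightmost-increasing (suc k) f inc = foldl-rightmostStep-increasing k (f ∘ suc) (f 0) (inc 0) (inc ∘ suc)

leftmostStep-≤ : ∀ {x q} → proj₁ q ≤ x → leftmostStep x q ≡ proj₁ q
leftmostStep-≤ {x} {q} q≤x with proj₁ q <ᵇ x in eq
... | true  = refl
... | false = ≤-antisym (≮⇒≥ λ q<x → subst T eq (<⇒<ᵇ q<x)) q≤x

leftmostStep-≥ : ∀ {x q} → x ≤ proj₁ q → leftmostStep x q ≡ x
leftmostStep-≥ {x} {q} x≤q = cong (λ b → if b then proj₁ q else x) (<ᵇ-false x≤q)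

foldl-leftmostStep-lowerBound : ∀ {x} xs → All (λ q → x ≤ proj₁ q) xs → foldl leftmostStep x xs ≡ x
foldl-leftmostStep-lowerBound         []       []           = refl
foldl-leftmostStep-lowerBound {x} (q ∷ xs) (x≤q ∷ x≤xs) =
  trans (cong (λ y → foldl leftmostStep y xs) (leftmostStep-≥ {q = q} x≤q)) (foldl-leftmostStep-lowerBound xs x≤xs)

label-hatDot : ∀ m → label (hatDot m) ≡ suc m
label-hatDot m = begin
  (3 + (8 * m + 5)) / 8   ≡⟨ cong (λ k → (3 + k) / 8) (+-comm (8 * m) 5) ⟩
  (8 + 8 * m) / 8         ≡⟨ cong (λ k → (8 + k) / 8) (*-comm 8 m) ⟩
  suc m * 8 / 8           ≡⟨ m*n/n≡m (suc m) 8 ⟩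
  suc m                   ∎

lines-hat : ∀ m → let ds = applyUpTo hatDot (suc m) in lines (suc m) (hat m) ds ds ≡ (suc m , 1) ∷ []
lines-hat m = begin
  lines (suc m) (hat m) ds ds
    ≡⟨ lines-unfold m (hat m) ds (hatDot 0) (applyUpTo (hatDot ∘ suc) m)
         (rightmost-increasing m hatDot hatDot-increasing) leftEnd offSegment-none ⟩
  (label (hatDot m) , label (5 , 1)) ∷ lines m (hat m) ds []
    ≡⟨ cong₂ (λ k σs → (k , 1) ∷ σs) (label-hatDot m) (lines-[] m (hat m) ds) ⟩
  (suc m , 1) ∷ [] ∎
  where
  ds : List Dot
  ds = applyUpTo hatDot (suc m)

  reachable : ∀ {t} → t < suc m → T (reachableFrom (hat m) (hatDot m) (hatDot t))
  reachable {t} t<sm = T-∧-intro (≤⇒≤ᵇ t≤m) (segUnder-true (hat m) 1 t≤m λ X'≤X X≤ →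
                          under-hat-low m (≤-trans (5≤hatDot t) X'≤X) X≤)
    where
    t≤m : proj₁ (hatDot t) ≤ proj₁ (hatDot m)
    t≤m = hatDot-mono-≤ (≤-pred t<sm)

  leftEnd : foldl leftmostStep (proj₁ (hatDot m)) (filterᵇ (reachableFrom (hat m) (hatDot m)) ds) ≡ 5
  leftEnd = begin
    foldl leftmostStep (proj₁ (hatDot m)) (filterᵇ (reachableFrom (hat m) (hatDot m)) ds)
      ≡⟨ cong (foldl leftmostStep (proj₁ (hatDot m)))
              (filter-all (T? ∘ reachableFrom (hat m) (hatDot m)) (applyUpTo⁺₁ hatDot (suc m) reachable)) ⟩
    foldl leftmostStep (leftmostStep (proj₁ (hatDot m)) (hatDot 0)) (applyUpTo (hatDot ∘ suc) m)
      ≡⟨ cong (λ x → foldl leftmostStep x (applyUpTo (hatDot ∘ suc) m)) (leftmostStep-≤ {q = hatDot 0} (5≤hatDot m)) ⟩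
    foldl leftmostStep 5 (applyUpTo (hatDot ∘ suc) m)
      ≡⟨ foldl-leftmostStep-lowerBound (applyUpTo (hatDot ∘ suc) m)
           (applyUpTo⁺₁ (hatDot ∘ suc) m λ {t} _ → 5≤hatDot (suc t)) ⟩
    5 ∎

  offSegment-none : filterᵇ (offSegment 5 (hatDot m)) ds ≡ []
  offSegment-none = filter-none (T? ∘ offSegment 5 (hatDot m)) (applyUpTo⁺₁ hatDot (suc m) λ {t} t<sm →
    T⇒¬T-not (T-∧-intro (≤⇒≤ᵇ (5≤hatDot t)) (≤⇒≤ᵇ (hatDot-mono-≤ (≤-pred t<sm)))))

φ-hat : ∀ m → φ (suc m) (hat m) ≡ applySigma (suc m , 1) (longest (suc m))
φ-hat m = begin
  φ (suc m) (hat m)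
    ≡⟨ φ-via-dots (suc m) (hat m) ds (dots-hat m) ⟩
  foldl (flip applySigma) (longest (suc m)) (lines (length ds) (hat m) ds ds)
    ≡⟨ cong (λ k → foldl (flip applySigma) (longest (suc m)) (lines k (hat m) ds ds)) (length-applyUpTo hatDot (suc m)) ⟩
  foldl (flip applySigma) (longest (suc m)) (lines (suc m) (hat m) ds ds)
    ≡⟨ cong (foldl (flip applySigma) (longest (suc m))) (lines-hat m) ⟩
  applySigma (suc m , 1) (longest (suc m)) ∎
  where
  ds : List Dot
  ds = applyUpTo hatDot (suc m)

foldl-swapAt-shift : ∀ k (h : ℕ → ℕ) b ρ →
  foldl (flip swapAt) (b ∷ ρ) (applyUpTo (suc ∘ suc ∘ h) k) ≡ b ∷ foldl (flip swapAt) ρ (applyUpTo (suc ∘ h) k)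
foldl-swapAt-shift zero    h b ρ = refl
foldl-swapAt-shift (suc k) h b ρ = foldl-swapAt-shift k (h ∘ suc) b (swapAt (suc (h 0)) ρ)

foldl-swapAt-rotate : ∀ (a : ℕ) xs → foldl (flip swapAt) (a ∷ xs) (applyUpTo suc (length xs)) ≡ xs ++ a ∷ []
foldl-swapAt-rotate a []       = refl
foldl-swapAt-rotate a (b ∷ xs) =
  trans (foldl-swapAt-shift (length xs) (λ t → t) b (a ∷ xs)) (cong (b ∷_) (foldl-swapAt-rotate a xs))

applySigma-rotate : ∀ (a : ℕ) xs → applySigma (length xs , 1) (a ∷ xs) ≡ xs ++ a ∷ []
applySigma-rotate a []           = refl
applySigma-rotate a xs@(_ ∷ _) =
  trans (cong (foldl (flip swapAt) (a ∷ xs)) (map-upTo suc (length xs))) (foldl-swapAt-rotate a xs)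

longest-suc : ∀ n → longest (suc n) ≡ suc (suc n) ∷ longest n
longest-suc n = trans (cong reverse (range1-suc (suc n))) (reverse-++ (range1 (suc n)) (suc (suc n) ∷ []))

length-longest : ∀ n → length (longest n) ≡ suc n
length-longest n = trans (length-reverse (range1 (suc n))) (length-range1 (suc n))

corollary3p3 : (n : ℕ) → 0 < n →
    (Φ n 1 ≡ reverse (range1 (suc n))) × (Φ n (r n) ≡ reverse (range1 n) ++ suc n ∷ [])
corollary3p3 (suc m) _ =
    (begin
      Φ (suc m) 1               ≡⟨ cong (φ (suc m)) (S-first (suc m)) ⟩
      φ (suc m) (flat (suc m))  ≡⟨ φ-flat (suc m) ⟩
      longest (suc m)           ∎)
  , (begin
      Φ (suc m) (r (suc m))
        ≡⟨ cong (φ (suc m)) (S-last m) ⟩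
      φ (suc m) (hat m)
        ≡⟨ φ-hat m ⟩
      applySigma (suc m , 1) (longest (suc m))
        ≡⟨ cong₂ (λ k π → applySigma (k , 1) π) (sym (length-longest m)) (longest-suc m) ⟩
      applySigma (length (longest m) , 1) (suc (suc m) ∷ longest m)
        ≡⟨ applySigma-rotate (suc (suc m)) (longest m) ⟩
      longest m ++ suc (suc m) ∷ [] ∎)
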